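{- For every integer $k \geq 3$, the graph $G_k$ contains no heavy cycle (cycle containing every edge of $A_k$) whose vertex set is $V(G_k) \setminus \{z\}$, and no heavy cycle whose vertex set is $V(G_k) \setminus \{v_k\}$.
   Context: For an integer $k \geq 1$, $G_k := K_k \vee P_{2k+1}$ is the join of a complete graph on vertices $x_1, \ldots, x_k$ with a path on $2k+1$ vertices whose vertices, in order along the path, are $u_1, u_2, \ldots, u_k, z, v_k, v_{k-1}, \ldots, v_1$ (every $x_i$ is adjacent to every path vertex and to every other $x_j$). The set of heavy edges of $G_k$ is $A_k = \{x_iu_i : 1 \leq i \leq k\} \cup \{x_iv_i : 1 \leq i \leq k-1\}$. A cycle of $G_k$ is heavy if it contains every edge of $A_k$. -}

module Defs where

open import Data.Nat using (ℕ; suc; _≤_)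
open import Data.Fin using (Fin; toℕ)
open import Data.List using (List; []; _∷_; _++_; [_]; length)
open import Data.List.Membership.Propositional using (_∈_)
open import Data.List.Relation.Unary.All using (All)
open import Data.List.Relation.Unary.Unique.Propositional using (Unique)
open import Data.Product using (_×_; _,_)
open import Data.Sum using (_⊎_)
open import Data.Unit using (⊤)
open import Data.Empty using (⊥)
open import Relation.Nullary using (¬_)
open import Relation.Binary.PropositionalEquality using (_≡_)

-- Vertices of G_k = K_k ∨ P_{2k+1}.  Indices are 0-based:
-- x i, u i, v i (i : Fin k) stand for x_{i+1}, u_{i+1}, v_{i+1}.
data V (k : ℕ) : Set where
  x : Fin k → V k
  u : Fin k → V k
  v : Fin k → V k
  z : V k

-- Path u_1 … u_k z v_k … v_1: consecutive indices are adjacent.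
Next : ∀ {k} → Fin k → Fin k → Set
Next i j = suc (toℕ i) ≡ toℕ j ⊎ suc (toℕ j) ≡ toℕ i

IsLast : ∀ {k} → Fin k → Set
IsLast {k} i = suc (toℕ i) ≡ k

Adj : ∀ {k} → V k → V k → Set
Adj (x i) (x j) = ¬ (i ≡ j)
Adj (x _) (u _) = ⊤
Adj (x _) (v _) = ⊤
Adj (x _) z     = ⊤
Adj (u _) (x _) = ⊤
Adj (v _) (x _) = ⊤
Adj z     (x _) = ⊤
Adj (u i) (u j) = Next i j
Adj (v i) (v j) = Next i j
Adj (u i) z     = IsLast i
Adj z     (u i) = IsLast i
Adj (v i) z     = IsLast i
Adj z     (v i) = IsLast i
Adj (u _) (v _) = ⊥
Adj (v _) (u _) = ⊥
Adj z     z     = ⊥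

consec : ∀ {A : Set} → List A → List (A × A)
consec (a ∷ b ∷ rest) = (a , b) ∷ consec (b ∷ rest)
consec _ = []

closedEdges : ∀ {A : Set} → List A → List (A × A)
closedEdges [] = []
closedEdges (w ∷ ws) = consec (w ∷ ws ++ [ w ])

IsCycle : ∀ {k} → List (V k) → Set
IsCycle ws = 3 ≤ length ws × Unique ws × All (λ { (a , b) → Adj a b }) (closedEdges ws)

HasEdge : ∀ {k} → List (V k) → V k → V k → Set
HasEdge ws a b = (a , b) ∈ closedEdges ws ⊎ (b , a) ∈ closedEdges ws

-- heavy: contains all x_i u_i (1 ≤ i ≤ k) and x_i v_i (1 ≤ i ≤ k-1)
Heavy : ∀ {k} → List (V k) → Set
Heavy {k} ws = (∀ (i : Fin k) → HasEdge ws (x i) (u i))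
             × (∀ (i : Fin k) → ¬ IsLast i → HasEdge ws (x i) (v i))

IsVk : ∀ {k} → V k → Set
IsVk (v i) = IsLast i
IsVk _ = ⊥

VertexSetIs : ∀ {k} → List (V k) → (V k → Set) → Set
VertexSetIs ws P = ∀ w → (w ∈ ws → P w) × (P w → w ∈ ws)

-- Every vertex of a cycle has exactly two cycle-neighbours, and a cycle all of whose edges lie
-- on another cycle is that cycle. In G_k each x_i with i < k is saturated by its two heavy
-- edges. If z is missing, this forces the neighbours of v_k to be x_k, v_{k-1} and those of
-- u_k to be x_k, u_{k-1}, so the cycle contains, hence is, the hexagon
-- u_k x_k v_k v_{k-1} x_{k-1} u_{k-1}; for k ≥ 3 it then misses x_1. If v_k is missing, the
-- neighbours of z are forced to be u_k and x_k, and the cycle is the triangle z u_k x_k.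
module Submission where

open import Defs
open import Data.Nat using (ℕ; suc; _≤_; s≤s; z≤n; _≟_)
open import Data.Nat.Properties using (suc-injective; 1+n≢n; <-irrefl)
open import Data.Fin using (Fin; toℕ; fromℕ; inject₁) renaming (zero to fzero)
open import Data.Fin.Properties using (toℕ-fromℕ; toℕ-inject₁; toℕ-injective; toℕ<n)
open import Data.List using (List; []; _∷_; _++_; [_]; length; map)
open import Data.List.Membership.Propositional using (_∈_)
open import Data.List.Membership.Propositional.Properties using (∈-map⁺; ∈-map⁻; ∈-++⁺ˡ)
open import Data.List.Relation.Binary.Subset.Propositional using (_⊆_)
open import Data.List.Relation.Binary.Permutation.Propositional using (↭-sym)
open import Data.List.Relation.Binary.Permutation.Propositional.Properties using (∈-resp-↭; ∷↭∷ʳ)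
open import Data.List.Relation.Unary.Any using (here; there)
open import Data.List.Relation.Unary.All as All using (All; []; _∷_)
open import Data.List.Relation.Unary.AllPairs using ([]; _∷_)
open import Data.List.Relation.Unary.Unique.Propositional using (Unique)
import Data.List.Relation.Unary.Unique.Propositional.Properties as Unique
open import Data.Product using (_×_; _,_; proj₁; proj₂; uncurry; ∃; ∃₂)
open import Data.Sum using (_⊎_; inj₁; inj₂; reduce; map₁) renaming (swap to ⊎-swap)
open import Data.Empty using (⊥-elim)
open import Function using (_∘_)
open import Relation.Nullary using (¬_; yes; no; Dec)
open import Relation.Binary.PropositionalEquality
  using (_≡_; _≢_; refl; sym; trans; cong; subst)

module _ {A : Set} where

  Link : List A → A → A → Set
  Link ws a b = (a , b) ∈ closedEdges ws ⊎ (b , a) ∈ closedEdges ws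

  Link-sym : ∀ {ws a b} → Link ws a b → Link ws b a
  Link-sym = ⊎-swap

  map-proj₁-consec : ∀ (l : List A) e → map proj₁ (consec (l ++ [ e ])) ≡ l
  map-proj₁-consec []          e = refl
  map-proj₁-consec (a ∷ [])    e = refl
  map-proj₁-consec (a ∷ b ∷ l) e = cong (a ∷_) (map-proj₁-consec (b ∷ l) e)

  map-proj₂-consec : ∀ (e : A) l → map proj₂ (consec (e ∷ l)) ≡ l
  map-proj₂-consec e []      = refl
  map-proj₂-consec e (a ∷ l) = cong (a ∷_) (map-proj₂-consec a l)

  ∈-sources : ∀ {ws} {a b : A} → (a , b) ∈ closedEdges ws → a ∈ ws
  ∈-sources {w ∷ ws} e = subst (_ ∈_) (map-proj₁-consec (w ∷ ws) w) (∈-map⁺ proj₁ e)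

  ∈-targets : ∀ {ws} {a b : A} → (a , b) ∈ closedEdges ws → b ∈ ws
  ∈-targets {w ∷ ws} e = ∈-resp-↭ (↭-sym (∷↭∷ʳ w ws))
    (subst (_ ∈_) (map-proj₂-consec w (ws ++ [ w ])) (∈-map⁺ proj₂ e))

  Link-∈ˡ : ∀ {ws} {a b : A} → Link ws a b → a ∈ ws
  Link-∈ˡ (inj₁ ab) = ∈-sources ab
  Link-∈ˡ (inj₂ ba) = ∈-targets ba

  Link-∈ʳ : ∀ {ws} {a b : A} → Link ws a b → b ∈ ws
  Link-∈ʳ {ws = ws} = Link-∈ˡ {ws = ws} ∘ Link-sym {ws = ws}

  successor : ∀ {ws} {w : A} → w ∈ ws → ∃ λ s → (w , s) ∈ closedEdges ws
  successor {w₀ ∷ ws} w∈ with ∈-map⁻ proj₁ (subst (_ ∈_) (sym (map-proj₁-consec (w₀ ∷ ws) w₀)) w∈)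
  ... | (_ , s) , e , refl = s , e

  predecessor : ∀ {ws} {w : A} → w ∈ ws → ∃ λ p → (p , w) ∈ closedEdges ws
  predecessor {w₀ ∷ ws} w∈
    with ∈-map⁻ proj₂ (subst (_ ∈_) (sym (map-proj₂-consec w₀ (ws ++ [ w₀ ])))
                             (∈-resp-↭ (∷↭∷ʳ w₀ ws) w∈))
  ... | (p , _) , e , refl = p , e

  unique-map-injective : ∀ {B : Set} (f : B → A) {xs p q} → Unique (map f xs) →
                         p ∈ xs → q ∈ xs → f p ≡ f q → p ≡ q
  unique-map-injective f _            (here refl) (here refl) _ = refl
  unique-map-injective f (p∉ ∷ _)     (here refl) (there q∈) e =
    ⊥-elim (All.lookup p∉ (∈-map⁺ f q∈) e)
  unique-map-injective f (q∉ ∷ _)     (there p∈) (here refl) e =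
    ⊥-elim (All.lookup q∉ (∈-map⁺ f p∈) (sym e))
  unique-map-injective f (_ ∷ unique) (there p∈) (there q∈) e =
    unique-map-injective f unique p∈ q∈ e

  unique-∷ʳ : ∀ {w : A} {ws} → Unique (w ∷ ws) → Unique (ws ++ [ w ])
  unique-∷ʳ (w∉ ∷ unique) =
    Unique.++⁺ unique ([] ∷ []) λ { (w∈ , here refl) → All.lookup w∉ w∈ refl }

  successor-unique : ∀ {ws} {a b c : A} → Unique ws →
                     (a , b) ∈ closedEdges ws → (a , c) ∈ closedEdges ws → b ≡ c
  successor-unique {w ∷ ws} unique ab ac = cong proj₂ (unique-map-injective proj₁
    (subst Unique (sym (map-proj₁-consec (w ∷ ws) w)) unique) ab ac refl)

  predecessor-unique : ∀ {ws} {a b c : A} → Unique ws →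
                       (b , a) ∈ closedEdges ws → (c , a) ∈ closedEdges ws → b ≡ c
  predecessor-unique {w ∷ ws} unique ba ca = cong proj₁ (unique-map-injective proj₂
    (subst Unique (sym (map-proj₂-consec w (ws ++ [ w ]))) (unique-∷ʳ unique)) ba ca refl)

  at-most-two-links : ∀ {ws} {w a b c : A} → Unique ws → Link ws w a → Link ws w b → a ≢ b →
                      Link ws w c → c ≡ a ⊎ c ≡ b
  at-most-two-links un (inj₁ wa) (inj₁ wb) a≢b _ = ⊥-elim (a≢b (successor-unique un wa wb))
  at-most-two-links un (inj₂ aw) (inj₂ bw) a≢b _ = ⊥-elim (a≢b (predecessor-unique un aw bw))
  at-most-two-links un (inj₁ wa) (inj₂ bw) _ (inj₁ wc) = inj₁ (successor-unique un wc wa)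
  at-most-two-links un (inj₁ wa) (inj₂ bw) _ (inj₂ cw) = inj₂ (predecessor-unique un cw bw)
  at-most-two-links un (inj₂ aw) (inj₁ wb) _ (inj₁ wc) = inj₂ (successor-unique un wc wb)
  at-most-two-links un (inj₂ aw) (inj₁ wb) _ (inj₂ cw) = inj₁ (predecessor-unique un cw aw)

  consec-forward : ∀ (P : A → Set) h r → (∀ {a b} → (a , b) ∈ consec (h ∷ r) → P a → P b) →
                   P h → ∀ {y} → y ∈ h ∷ r → P y
  consec-forward P h r       step Ph (here refl) = Ph
  consec-forward P h (b ∷ r) step Ph (there y∈)  =
    consec-forward P b r (step ∘ there) (step (here refl) Ph) y∈

  consec-backward : ∀ (P : A → Set) h r → (∀ {a b} → (a , b) ∈ consec (h ∷ r) → P b → P a) →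
                    ∀ {y} → y ∈ h ∷ r → P y → P h
  consec-backward P h r       step (here refl) Py = Py
  consec-backward P h (b ∷ r) step (there y∈)  Py =
    step (here refl) (consec-backward P b r (step ∘ there) y∈ Py)

  Link-closed-spans : ∀ (P : A → Set) ws → (∀ {a b} → Link ws a b → P a → P b) →
                      ∀ {y} → y ∈ ws → P y → ∀ {y'} → y' ∈ ws → P y'
  Link-closed-spans P (w ∷ ws) closed y∈ Py y'∈ =
    consec-forward P w (ws ++ [ w ]) (closed ∘ inj₁)
      (consec-backward P w (ws ++ [ w ]) (closed ∘ inj₂) (∈-++⁺ˡ y∈) Py) (∈-++⁺ˡ y'∈)

  no-three-in-pair : ∀ {ws} {p q : A} → 3 ≤ length ws → Unique ws →
                     ¬ (∀ {y} → y ∈ ws → y ≡ p ⊎ y ≡ q)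
  no-three-in-pair {a ∷ b ∷ c ∷ _} (s≤s (s≤s (s≤s _))) ((a≢b ∷ a≢c ∷ _) ∷ (b≢c ∷ _) ∷ _) pair
    with pair (here refl) | pair (there (here refl)) | pair (there (there (here refl)))
  ... | inj₁ refl | inj₁ refl | _         = a≢b refl
  ... | inj₁ refl | inj₂ refl | inj₁ refl = a≢c refl
  ... | inj₁ refl | inj₂ refl | inj₂ refl = b≢c refl
  ... | inj₂ refl | inj₁ refl | inj₁ refl = b≢c refl
  ... | inj₂ refl | inj₁ refl | inj₂ refl = a≢c refl
  ... | inj₂ refl | inj₂ refl | _         = a≢b refl

  two-links : ∀ {ws} {w : A} → 3 ≤ length ws → Unique ws → w ∈ ws →
              ∃₂ λ a b → a ≢ b × Link ws w a × Link ws w b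
  two-links {ws} {w} len un w∈ with successor w∈ | predecessor w∈
  ... | s , ws⃗ | p , p⃗w = s , p , s≢p , inj₁ ws⃗ , inj₂ p⃗w
    where
    s≢p : s ≢ p
    s≢p refl = no-three-in-pair len un (Link-closed-spans _ ws closed w∈ (inj₁ refl))
      where
      -- with s = p the pair {w, s} is closed under links, so the cycle would have two vertices
      closed : ∀ {c d} → Link ws c d → c ≡ w ⊎ c ≡ s → d ≡ w ⊎ d ≡ s
      closed (inj₁ cd) (inj₁ refl) = inj₂ (successor-unique un cd ws⃗)
      closed (inj₂ dc) (inj₁ refl) = inj₂ (predecessor-unique un dc p⃗w)
      closed (inj₁ cd) (inj₂ refl) = inj₁ (successor-unique un cd p⃗w)
      closed (inj₂ dc) (inj₂ refl) = inj₁ (predecessor-unique un dc ws⃗)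

  links-both : ∀ {ws} {w p q : A} → 3 ≤ length ws → Unique ws → w ∈ ws →
               (∀ {c} → Link ws w c → c ≡ p ⊎ c ≡ q) → Link ws w p × Link ws w q
  links-both len un w∈ only with two-links len un w∈
  ... | a , b , a≢b , wa , wb with only wa | only wb
  ... | inj₁ refl | inj₁ refl = ⊥-elim (a≢b refl)
  ... | inj₁ refl | inj₂ refl = wa , wb
  ... | inj₂ refl | inj₁ refl = wb , wa
  ... | inj₂ refl | inj₂ refl = ⊥-elim (a≢b refl)

  subcycle-⊇ : ∀ {ws cs : List A} → Unique ws → 3 ≤ length cs → Unique cs →
               All (uncurry (Link ws)) (closedEdges cs) → ws ⊆ cs
  subcycle-⊇ {ws} {cs@(_ ∷ _ ∷ _)} un len@(s≤s (s≤s _)) uncs edges =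
    Link-closed-spans (_∈ cs) ws closed (Link-∈ˡ (All.lookup edges (here refl))) (here refl)
    where
    lift : ∀ {a b} → Link cs a b → Link ws a b
    lift (inj₁ ab) = All.lookup edges ab
    lift (inj₂ ba) = Link-sym {ws = ws} (All.lookup edges ba)

    closed : ∀ {a b} → Link ws a b → a ∈ cs → b ∈ cs
    closed ab a∈ with two-links len uncs a∈
    ... | p , q , p≢q , ap , aq with at-most-two-links un (lift ap) (lift aq) p≢q ab
    ...   | inj₁ refl = Link-∈ʳ ap
    ...   | inj₂ refl = Link-∈ʳ aq

x-injective : ∀ {k} {i j : Fin k} → x i ≡ x j → i ≡ j
x-injective refl = refl

u-injective : ∀ {k} {i j : Fin k} → u i ≡ u j → i ≡ j
u-injective refl = refl

v-injective : ∀ {k} {i j : Fin k} → v i ≡ v j → i ≡ j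
v-injective refl = refl

IsLast? : ∀ {k} (i : Fin k) → Dec (IsLast i)
IsLast? {k} i = suc (toℕ i) ≟ k

IsLast-unique : ∀ {k} {i j : Fin k} → IsLast i → IsLast j → i ≡ j
IsLast-unique i-last j-last = toℕ-injective (suc-injective (trans i-last (sym j-last)))

Next-last : ∀ {k} {i j : Fin k} → IsLast j → Next i j → suc (toℕ i) ≡ toℕ j
Next-last         j-last (inj₁ i→j) = i→j
Next-last {i = i} j-last (inj₂ j→i) = ⊥-elim (<-irrefl (trans (sym j→i) j-last) (toℕ<n i))

module HeavyCycle {k} {ws : List (V k)} (cycle : IsCycle ws) (heavy : Heavy ws)
                  (L : Fin k) (L-last : IsLast L) where

  private
    len : 3 ≤ length ws
    len = proj₁ cycle

    unique : Unique ws
    unique = proj₁ (proj₂ cycle)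

  Link-Adj : ∀ {a b} → Link ws a b → Adj a b ⊎ Adj b a
  Link-Adj (inj₁ ab) = inj₁ (All.lookup (proj₂ (proj₂ cycle)) ab)
  Link-Adj (inj₂ ba) = inj₂ (All.lookup (proj₂ (proj₂ cycle)) ba)

  x-saturated : ∀ {j c} → ¬ IsLast j → Link ws (x j) c → c ≡ u j ⊎ c ≡ v j
  x-saturated {j} ¬last = at-most-two-links unique (proj₁ heavy j) (proj₂ heavy j ¬last) (λ ())

  x-linked-to-last : ∀ {j c} → Link ws (x j) c → c ≡ u L ⊎ c ≡ v L → j ≡ L
  x-linked-to-last {j} link c≡ with IsLast? j
  ... | yes j-last = IsLast-unique j-last L-last
  ... | no ¬last with x-saturated ¬last link | c≡
  ...   | inj₁ refl | inj₁ e  = u-injective e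
  ...   | inj₂ refl | inj₂ e  = v-injective e
  ...   | inj₁ refl | inj₂ ()
  ...   | inj₂ refl | inj₁ ()

  ¬vertexSet-V∖vₖ : ∀ {i} → i ≢ L → ¬ VertexSetIs ws (λ w → ¬ IsVk w)
  ¬vertexSet-V∖vₖ {i} i≢L spans =
    x-i∉triangle (subcycle-⊇ unique (s≤s (s≤s (s≤s z≤n))) triangle-unique edges (∈ws (λ ())))
    where
    ∈ws : ∀ {w} → ¬ IsVk w → w ∈ ws
    ∈ws = proj₂ (spans _)

    z-links : ∀ {c} → Link ws z c → c ≡ u L ⊎ c ≡ x L
    z-links {x j} link with IsLast? j
    ... | yes j-last = inj₂ (cong x (IsLast-unique j-last L-last))
    ... | no ¬last with x-saturated ¬last (Link-sym {ws = ws} link)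
    ...   | inj₁ ()
    ...   | inj₂ ()
    z-links {u j} link = inj₁ (cong u (IsLast-unique (reduce (Link-Adj link)) L-last))
    z-links {v j} link = ⊥-elim (proj₁ (spans _) (Link-∈ʳ {ws = ws} link) (reduce (Link-Adj link)))
    z-links {z}   link = ⊥-elim (reduce (Link-Adj link))

    triangle : List (V k)
    triangle = z ∷ u L ∷ x L ∷ []

    triangle-unique : Unique triangle
    triangle-unique = ((λ ()) ∷ (λ ()) ∷ []) ∷ ((λ ()) ∷ []) ∷ [] ∷ []

    edges : All (uncurry (Link ws)) (closedEdges triangle)
    edges with links-both len unique (∈ws (λ ())) z-links
    ... | z-uL , z-xL = z-uL ∷ Link-sym {ws = ws} (proj₁ heavy L) ∷ Link-sym {ws = ws} z-xL ∷ []

    x-i∉triangle : ¬ x i ∈ triangle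
    x-i∉triangle (here ())
    x-i∉triangle (there (here ()))
    x-i∉triangle (there (there (here e))) = i≢L (x-injective e)

  module _ (J : Fin k) (J→L : suc (toℕ J) ≡ toℕ L) where

    J≢L : J ≢ L
    J≢L J≡L = 1+n≢n (trans J→L (cong toℕ (sym J≡L)))

    J-not-last : ¬ IsLast J
    J-not-last J-last = 1+n≢n (trans L-last (sym (trans (sym J→L) J-last)))

    link-to-J : ∀ {j} → Next L j ⊎ Next j L → j ≡ J
    link-to-J next =
      toℕ-injective (suc-injective (trans (Next-last L-last (reduce (map₁ ⊎-swap next))) (sym J→L)))

    ¬vertexSet-V∖z : ∀ {i} → i ≢ L → i ≢ J → ¬ VertexSetIs ws (λ w → ¬ (w ≡ z))
    ¬vertexSet-V∖z {i} i≢L i≢J spans =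
      x-i∉hexagon (subcycle-⊇ unique (s≤s (s≤s (s≤s z≤n))) hexagon-unique edges (∈ws (λ ())))
      where
      ∈ws : ∀ {w} → ¬ (w ≡ z) → w ∈ ws
      ∈ws = proj₂ (spans _)

      z∉ws : ¬ z ∈ ws
      z∉ws z∈ = proj₁ (spans z) z∈ refl

      vL-links : ∀ {c} → Link ws (v L) c → c ≡ x L ⊎ c ≡ v J
      vL-links {x j} link = inj₁ (cong x (x-linked-to-last (Link-sym {ws = ws} link) (inj₂ refl)))
      vL-links {u j} link = ⊥-elim (reduce (Link-Adj link))
      vL-links {v j} link = inj₂ (cong v (link-to-J (Link-Adj link)))
      vL-links {z}   link = ⊥-elim (z∉ws (Link-∈ʳ {ws = ws} link))

      uL-links : ∀ {c} → Link ws (u L) c → c ≡ x L ⊎ c ≡ u J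
      uL-links {x j} link = inj₁ (cong x (x-linked-to-last (Link-sym {ws = ws} link) (inj₁ refl)))
      uL-links {u j} link = inj₂ (cong u (link-to-J (Link-Adj link)))
      uL-links {v j} link = ⊥-elim (reduce (Link-Adj link))
      uL-links {z}   link = ⊥-elim (z∉ws (Link-∈ʳ {ws = ws} link))

      hexagon : List (V k)
      hexagon = u L ∷ x L ∷ v L ∷ v J ∷ x J ∷ u J ∷ []

      hexagon-unique : Unique hexagon
      hexagon-unique =
        ((λ ()) ∷ (λ ()) ∷ (λ ()) ∷ (λ ()) ∷ (J≢L ∘ sym ∘ u-injective) ∷ []) ∷
        ((λ ()) ∷ (λ ()) ∷ (J≢L ∘ sym ∘ x-injective) ∷ (λ ()) ∷ []) ∷
        ((J≢L ∘ sym ∘ v-injective) ∷ (λ ()) ∷ (λ ()) ∷ []) ∷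
        ((λ ()) ∷ (λ ()) ∷ []) ∷
        ((λ ()) ∷ []) ∷ [] ∷ []

      edges : All (uncurry (Link ws)) (closedEdges hexagon)
      edges with links-both len unique (∈ws (λ ())) vL-links
               | links-both len unique (∈ws (λ ())) uL-links
      ... | vL-xL , vL-vJ | _ , uL-uJ =
        Link-sym {ws = ws} (proj₁ heavy L) ∷ Link-sym {ws = ws} vL-xL ∷ vL-vJ ∷
        Link-sym {ws = ws} (proj₂ heavy J J-not-last) ∷ proj₁ heavy J ∷
        Link-sym {ws = ws} uL-uJ ∷ []

      x-i∉hexagon : ¬ x i ∈ hexagon
      x-i∉hexagon (here ())
      x-i∉hexagon (there (here e)) = i≢L (x-injective e)
      x-i∉hexagon (there (there (here ())))
      x-i∉hexagon (there (there (there (here ()))))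
      x-i∉hexagon (there (there (there (there (here e))))) = i≢J (x-injective e)
      x-i∉hexagon (there (there (there (there (there (here ()))))))

lemma2p5 : (k : ℕ) → 3 ≤ k → (ws : List (V k)) → IsCycle ws → Heavy ws →
           ¬ VertexSetIs ws (λ w → ¬ (w ≡ z)) × ¬ VertexSetIs ws (λ w → ¬ IsVk w)
lemma2p5 (suc (suc (suc m))) (s≤s (s≤s (s≤s z≤n))) ws cycle heavy =
  ¬vertexSet-V∖z J J→L {fzero} (λ ()) (λ ()) , ¬vertexSet-V∖vₖ {fzero} (λ ())
  where
  L : Fin (suc (suc (suc m)))
  L = fromℕ (suc (suc m))

  J : Fin (suc (suc (suc m)))
  J = inject₁ (fromℕ (suc m))

  J→L : suc (toℕ J) ≡ toℕ L
  J→L = trans (cong suc (trans (toℕ-inject₁ _) (toℕ-fromℕ _))) (sym (toℕ-fromℕ _))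

  open HeavyCycle cycle heavy L (cong suc (toℕ-fromℕ _))
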